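{- Let $x^*$ be a basic optimal solution of the linear program $LR$ (defined in the context) which has at least one fractional (non-integer) component. Then there exists $(S,k)\in X$ with $|S|\ge 2$ such that $x^{*k}_S$ is fractional.
   Context: Let $G=(V,E)$ be a finite simple undirected graph, $K$ a finite set (of representative colors), and for each $k\in K$ let $V_k\subseteq V$, $m(k)$ a positive integer, and $w_k$ a nonnegative integer. Let $G_k=G[V_k]$ and let $\mathscr{S}_k$ be the set of non-empty stable sets of $G_k$. Let $X=\{(S,k): k\in K,\ S\in\mathscr{S}_k\}$. The linear program $LR$ has variables $x^k_S$ for $(S,k)\in X$ and reads: minimize $\sum_{(S,k)\in X} w_k x^k_S$ subject to $\sum_{(S,k)\in X:\, v\in S} x^k_S\ge 1$ for every $v\in V$, $\sum_{S\in\mathscr{S}_k}x^k_S\le m(k)$ for every $k\in K$, and $x^k_S\ge 0$ for all $(S,k)\in X$. -}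

module Defs where

open import Data.Nat as ℕ using (ℕ; zero; suc)
open import Data.Integer as ℤ using (ℤ)
open import Data.Rational as ℚ using (ℚ; 0ℚ; 1ℚ)
open import Data.Bool using (Bool; true; false; _∧_; _∨_; not; if_then_else_)
open import Data.Fin using (Fin)
open import Data.Fin.Subset using (Subset; ∣_∣)
open import Data.Vec using (Vec; []; _∷_; lookup)
open import Data.List using (List; []; _∷_; _++_; map; foldr; allFin)
open import Data.Bool.ListAction using (all; any)
open import Data.Product using (Σ; _×_)
open import Relation.Binary.PropositionalEquality using (_≡_)

record SimpleGraph (n : ℕ) : Set where
  field
    adj    : Fin n → Fin n → Bool
    sym    : ∀ u v → adj u v ≡ adj v u
    irrefl : ∀ v → adj v v ≡ false
open SimpleGraph public

ℕ→ℚ : ℕ → ℚ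
ℕ→ℚ k = ℚ._/_ (ℤ.+ k) 1

allSubsets : (n : ℕ) → List (Subset n)
allSubsets zero    = [] ∷ []
allSubsets (suc n) = map (true ∷_) (allSubsets n) ++ map (false ∷_) (allSubsets n)

Σℚ : {A : Set} → List A → (A → ℚ) → ℚ
Σℚ xs f = foldr (λ a acc → f a ℚ.+ acc) 0ℚ xs

module _ {n : ℕ} (G : SimpleGraph n) where

  subsetᵇ : Subset n → Subset n → Bool
  subsetᵇ S T = all (λ v → not (lookup S v) ∨ lookup T v) (allFin n)

  stableᵇ : Subset n → Bool
  stableᵇ S = all (λ u → all (λ v → not (lookup S u ∧ lookup S v ∧ adj G u v)) (allFin n)) (allFin n)

  nonemptyᵇ : Subset n → Bool
  nonemptyᵇ S = any (lookup S) (allFin n)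

  -- S ∈ 𝒮_k : non-empty stable set of G_k = G[V_k]
  -- (a subset of V_k is stable in G[V_k] iff it is stable in G)
  inStableᵇ : Subset n → Subset n → Bool
  inStableᵇ Vk S = subsetᵇ S Vk ∧ stableᵇ S ∧ nonemptyᵇ S

-- Data of the linear program LR: representative colours K = Fin c,
-- V_k ⊆ V, m(k) and w_k.
record LRData (n c : ℕ) : Set where
  field
    graph : SimpleGraph n
    Vk    : Fin c → Subset n
    m     : Fin c → ℕ
    w     : Fin c → ℕ
open LRData public

-- Assignments of values x^k_S; only entries with (S,k) ∈ X are meaningful.
Assignment : ℕ → ℕ → Set
Assignment n c = Fin c → Subset n → ℚ

module LR {n c : ℕ} (D : LRData n c) where

  inX : Fin c → Subset n → Bool
  inX k S = inStableᵇ (graph D) (Vk D k) S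

  InX : Fin c → Subset n → Set
  InX k S = inX k S ≡ true

  ΣX : (Fin c → Subset n → ℚ) → ℚ
  ΣX f = Σℚ (allFin c) λ k → Σℚ (allSubsets n) λ S → if inX k S then f k S else 0ℚ

  coverLHS : Assignment n c → Fin n → ℚ
  coverLHS x v = ΣX λ k S → if lookup S v then x k S else 0ℚ

  capLHS : Assignment n c → Fin c → ℚ
  capLHS x k = Σℚ (allSubsets n) λ S → if inX k S then x k S else 0ℚ

  cost : Assignment n c → ℚ
  cost x = ΣX λ k S → ℕ→ℚ (w D k) ℚ.* x k S

  Feasible : Assignment n c → Set
  Feasible x = (∀ v → 1ℚ ℚ.≤ coverLHS x v)
             × (∀ k → capLHS x k ℚ.≤ ℕ→ℚ (m D k))
             × (∀ k S → InX k S → 0ℚ ℚ.≤ x k S)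

  Optimal : Assignment n c → Set
  Optimal x = Feasible x × (∀ y → Feasible y → cost x ℚ.≤ cost y)

  -- Basic solution: x is feasible and is the unique solution (on the
  -- variables of X) of the system of constraints that are tight at x,
  -- i.e. the tight constraints have full column rank.
  Basic : Assignment n c → Set
  Basic x = Feasible x ×
    (∀ y → (∀ v → coverLHS x v ≡ 1ℚ → coverLHS y v ≡ 1ℚ)
         → (∀ k → capLHS x k ≡ ℕ→ℚ (m D k) → capLHS y k ≡ ℕ→ℚ (m D k))
         → (∀ k S → InX k S → x k S ≡ 0ℚ → y k S ≡ 0ℚ)
         → ∀ k S → InX k S → y k S ≡ x k S)

IsIntegral : ℚ → Set
IsIntegral q = Σ ℤ λ z → q ≡ ℚ._/_ z 1

Fractional : ℚ → Set
Fractional q = IsIntegral q → Data.Empty.⊥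
  where import Data.Empty

{-# OPTIONS --safe #-}

-- Suppose every variable x^k_S with |S| ≥ 2 is integral.  A singleton variable x^k_{v} occurs in
-- exactly two constraints, the covering constraint of v and the capacity constraint of k, so the
-- fractional singleton variables are the edges of a bipartite graph on the constraints.  All
-- right-hand sides are integers, hence a tight constraint never contains exactly one fractional
-- variable.  A walk along fractional variables that never turns back at a tight constraint therefore
-- ends in a cycle or at a second non-tight constraint.  Adding +1 and −1 alternately along that
-- cycle or path keeps every tight constraint tight and every zero variable zero, so the tight
-- constraints do not determine x: x is not basic.

module Submission where

open import Algebra.Properties.Group using (identityʳ-unique)
open import Data.Bool using (Bool; true; false; _∧_; not; if_then_else_)
open import Data.Bool.ListAction using (any)
open import Data.Bool.Properties as Boolᴾ using (T-≡; T-∧)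
open import Data.Fin using (Fin; zero; suc; toℕ; fromℕ<; join; splitAt)
open import Data.Fin.Properties using (_≟_; any?; pigeonhole; toℕ<n; toℕ-fromℕ<; splitAt-join)
open import Data.Fin.Subset using (Subset; ⁅_⁆; ∣_∣) renaming (⊥ to ∅)
open import Data.Fin.Subset.Properties using (∣⁅x⁆∣≡1; anySubset?)
open import Data.Integer as ℤ using ()
open import Data.List using (List; []; _∷_; _++_; map; allFin; upTo)
open import Data.List.Membership.Propositional using (_∈_)
open import Data.List.Membership.Propositional.Properties using (∈-upTo⁻)
open import Data.List.Properties using (map-tabulate; map-upTo)
open import Data.List.Relation.Unary.Any using (here; there; satisfied)
open import Data.List.Relation.Unary.Any.Properties using (any⁻)
open import Data.Nat as ℕ using (ℕ; zero; suc; _∸_; _<_; _≤_; z≤n; s≤s)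
open import Data.Nat.Coprimality as Coprime using ()
open import Data.Nat.Properties as ℕᴾ using ()
open import Data.Product using (Σ; ∃; _×_; _,_; proj₁; proj₂; map₂)
open import Data.Rational as ℚ using (ℚ; mkℚ; 0ℚ; 1ℚ; _+_; _*_; -_; _-_)
open import Data.Rational.Properties as ℚᴾ using ()
open import Data.Rational.Solver using (module +-*-Solver)
open import Data.Sum as Sum using (_⊎_; inj₁; inj₂; [_,_]′)
open import Data.Sum.Properties as Sumᴾ using ()
open import Data.Vec using ([]; _∷_; lookup)
open import Data.Vec.Properties using (≡-dec; ∷-injectiveʳ; lookup-replicate)
open import Defs hiding (sym)
open import Function using (_∘_; id)
open import Function.Bundles using (Equivalence)
open import Relation.Binary using (DecidableEquality)
open import Relation.Binary.PropositionalEquality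
open import Relation.Nullary using (¬_; Dec; does; yes; no; contradiction)
open import Relation.Nullary.Decidable as Dec using (_×-dec_; _⊎-dec_; ¬?; decidable-stable; dec-true; dec-false)
open import Relation.Unary using (Decidable)

open +-*-Solver using (solve; _:+_; _:-_; _:=_)

record Integral (q : ℚ) : Set where
  constructor integral
  field
    denominator≡1 : ℚ.denominator-1 q ≡ 0

integral? : Decidable Integral
integral? q = Dec.map′ integral Integral.denominator≡1 (ℚ.denominator-1 q ℕ.≟ 0)

integral-/1 : ∀ z → Integral (z ℚ./ 1)
integral-/1 (ℤ.+ n) = integral
  (cong ℚ.denominator-1 (ℚᴾ.normalize-coprime {n} {0} (Coprime.sym (Coprime.1-coprimeTo n))))
integral-/1 ℤ.-[1+ n ] = integral
  (cong (ℚ.denominator-1 ∘ -_) (ℚᴾ.normalize-coprime {suc n} {0} (Coprime.sym (Coprime.1-coprimeTo (suc n)))))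

integral⇒isIntegral : ∀ {q} → Integral q → IsIntegral q
integral⇒isIntegral {mkℚ z _ _} (integral refl) = z , sym (ℚᴾ.↥p/↧p≡p _)

isIntegral⇒integral : ∀ {q} → IsIntegral q → Integral q
isIntegral⇒integral (z , refl) = integral-/1 z

integral-+ : ∀ p q → Integral p → Integral q → Integral (p + q)
integral-+ p@(mkℚ _ _ _) q@(mkℚ _ _ _) (integral refl) (integral refl) =
  integral-/1 (ℚ.↥ p ℤ.* ℚ.↧ q ℤ.+ ℚ.↥ q ℤ.* ℚ.↧ p)

integral-neg : ∀ p → Integral p → Integral (- p)
integral-neg (mkℚ (ℤ.+ zero)  _ _) (integral refl) = integral refl
integral-neg (mkℚ (ℤ.+ suc _) _ _) (integral refl) = integral refl
integral-neg (mkℚ ℤ.-[1+ _ ]  _ _) (integral refl) = integral refl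

integral-cancelʳ : ∀ p q → Integral (p + q) → Integral q → Integral p
integral-cancelʳ p q p+q-integral q-integral =
  subst Integral (solve 2 (λ p q → (p :+ q) :- q := p) refl p q)
    (integral-+ (p + q) (- q) p+q-integral (integral-neg q q-integral))

Σℚ-cong : ∀ {A : Set} (xs : List A) {f g : A → ℚ} → (∀ a → f a ≡ g a) → Σℚ xs f ≡ Σℚ xs g
Σℚ-cong []       f≗g = refl
Σℚ-cong (a ∷ xs) f≗g = cong₂ _+_ (f≗g a) (Σℚ-cong xs f≗g)

Σℚ-zero : ∀ {A : Set} (xs : List A) {f : A → ℚ} → (∀ {a} → a ∈ xs → f a ≡ 0ℚ) → Σℚ xs f ≡ 0ℚ
Σℚ-zero []       f≡0 = refl
Σℚ-zero (a ∷ xs) f≡0 = cong₂ _+_ (f≡0 (here refl)) (Σℚ-zero xs (f≡0 ∘ there))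

Σℚ-+ : ∀ {A : Set} (xs : List A) (f g : A → ℚ) → Σℚ xs (λ a → f a + g a) ≡ Σℚ xs f + Σℚ xs g
Σℚ-+ []       f g = refl
Σℚ-+ (a ∷ xs) f g = trans (cong (f a + g a +_) (Σℚ-+ xs f g))
  (solve 4 (λ p q r s → (p :+ q) :+ (r :+ s) := (p :+ r) :+ (q :+ s)) refl (f a) (g a) _ _)

Σℚ-*ˡ : ∀ {A : Set} (xs : List A) (s : ℚ) (f : A → ℚ) → Σℚ xs (λ a → s * f a) ≡ s * Σℚ xs f
Σℚ-*ˡ []       s f = sym (ℚᴾ.*-zeroʳ s)
Σℚ-*ˡ (a ∷ xs) s f = trans (cong (s * f a +_) (Σℚ-*ˡ xs s f)) (sym (ℚᴾ.*-distribˡ-+ s (f a) _))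

Σℚ-comm : ∀ {A B : Set} (xs : List A) (ys : List B) (f : A → B → ℚ) →
          Σℚ xs (λ a → Σℚ ys (f a)) ≡ Σℚ ys (λ b → Σℚ xs (λ a → f a b))
Σℚ-comm []       ys f = sym (Σℚ-zero ys (λ _ → refl))
Σℚ-comm (a ∷ xs) ys f = trans (cong (Σℚ ys (f a) +_) (Σℚ-comm xs ys f)) (sym (Σℚ-+ ys (f a) _))

Σℚ-integral : ∀ {A : Set} (xs : List A) {f : A → ℚ} → (∀ a → Integral (f a)) → Integral (Σℚ xs f)
Σℚ-integral []       f-integral = integral refl
Σℚ-integral (a ∷ xs) f-integral = integral-+ _ _ (f-integral a) (Σℚ-integral xs f-integral)

Σℚ-++ : ∀ {A : Set} (xs ys : List A) (f : A → ℚ) → Σℚ (xs ++ ys) f ≡ Σℚ xs f + Σℚ ys f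
Σℚ-++ []       ys f = sym (ℚᴾ.+-identityˡ _)
Σℚ-++ (a ∷ xs) ys f = trans (cong (f a +_) (Σℚ-++ xs ys f)) (sym (ℚᴾ.+-assoc (f a) _ _))

Σℚ-map : ∀ {A B : Set} (g : A → B) (xs : List A) (f : B → ℚ) → Σℚ (map g xs) f ≡ Σℚ xs (f ∘ g)
Σℚ-map g []       f = refl
Σℚ-map g (a ∷ xs) f = cong (f (g a) +_) (Σℚ-map g xs f)

Σℚ-upTo-suc : ∀ L (f : ℕ → ℚ) → Σℚ (upTo (suc L)) f ≡ f 0 + Σℚ (upTo L) (f ∘ suc)
Σℚ-upTo-suc L f =
  cong (f 0 +_) (trans (cong (λ ts → Σℚ ts f) (sym (map-upTo suc L))) (Σℚ-map suc (upTo L) f))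

Σℚ-upTo-head : ∀ {L} (f : ℕ → ℚ) → 0 < L → (∀ {t} → 0 < t → t < L → f t ≡ 0ℚ) → Σℚ (upTo L) f ≡ f 0
Σℚ-upTo-head {suc L} f _ later≡0 = begin
  Σℚ (upTo (suc L)) f
    ≡⟨ Σℚ-upTo-suc L f ⟩
  f 0 + Σℚ (upTo L) (f ∘ suc)
    ≡⟨ cong (f 0 +_) (Σℚ-zero (upTo L) λ t∈ → later≡0 (s≤s z≤n) (s≤s (∈-upTo⁻ t∈))) ⟩
  f 0 + 0ℚ
    ≡⟨ ℚᴾ.+-identityʳ (f 0) ⟩
  f 0   ∎
  where open ≡-Reasoning

telescope : ∀ L (f : ℕ → ℚ) → Σℚ (upTo L) (λ t → f t - f (suc t)) ≡ f 0 - f L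
telescope zero    f = sym (ℚᴾ.+-inverseʳ (f 0))
telescope (suc L) f = begin
  Σℚ (upTo (suc L)) (λ t → f t - f (suc t))
    ≡⟨ Σℚ-upTo-suc L (λ t → f t - f (suc t)) ⟩
  (f 0 - f 1) + Σℚ (upTo L) (λ t → f (suc t) - f (suc (suc t)))
    ≡⟨ cong ((f 0 - f 1) +_) (telescope L (f ∘ suc)) ⟩
  (f 0 - f 1) + (f 1 - f (suc L))
    ≡⟨ solve 3 (λ a b c → (a :- b) :+ (b :- c) := a :- c) refl (f 0) (f 1) (f (suc L)) ⟩
  f 0 - f (suc L)   ∎
  where open ≡-Reasoning

when : Bool → ℚ → ℚ
when b q = if b then q else 0ℚ

when-+ : ∀ b p q → when b (p + q) ≡ when b p + when b q
when-+ true  p q = refl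
when-+ false p q = refl

when-*ˡ : ∀ b s q → when b (s * q) ≡ s * when b q
when-*ˡ true  s q = refl
when-*ˡ false s q = sym (ℚᴾ.*-zeroʳ s)

when-Σℚ : ∀ {A : Set} b (xs : List A) (f : A → ℚ) → when b (Σℚ xs f) ≡ Σℚ xs (λ a → when b (f a))
when-Σℚ true  xs f = refl
when-Σℚ false xs f = sym (Σℚ-zero xs (λ _ → refl))

when-swap : ∀ a b q → when a (when b q) ≡ when b (when a q)
when-swap true  b     q = refl
when-swap false true  q = refl
when-swap false false q = refl

Σℚ-allFin-suc : ∀ m (f : Fin (suc m) → ℚ) → Σℚ (allFin (suc m)) f ≡ f zero + Σℚ (allFin m) (f ∘ suc)
Σℚ-allFin-suc m f =
  cong (f zero +_) (trans (cong (λ is → Σℚ is f) (sym (map-tabulate id suc))) (Σℚ-map suc (allFin m) f))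

Σℚ-allFin-point : ∀ {m} (j : Fin m) (f : Fin m → ℚ) →
                  Σℚ (allFin m) (λ i → when (does (i ≟ j)) (f i)) ≡ f j
Σℚ-allFin-point {suc m} zero f = begin
  Σℚ (allFin (suc m)) (λ i → when (does (i ≟ zero)) (f i))
    ≡⟨ Σℚ-allFin-suc m (λ i → when (does (i ≟ zero)) (f i)) ⟩
  f zero + Σℚ (allFin m) (λ _ → 0ℚ)   ≡⟨ cong (f zero +_) (Σℚ-zero (allFin m) (λ _ → refl)) ⟩
  f zero + 0ℚ                         ≡⟨ ℚᴾ.+-identityʳ (f zero) ⟩
  f zero                              ∎
  where open ≡-Reasoning
Σℚ-allFin-point {suc m} (suc j) f = begin
  Σℚ (allFin (suc m)) (λ i → when (does (i ≟ suc j)) (f i))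
    ≡⟨ Σℚ-allFin-suc m (λ i → when (does (i ≟ suc j)) (f i)) ⟩
  0ℚ + Σℚ (allFin m) (λ i → when (does (i ≟ j)) (f (suc i)))   ≡⟨ ℚᴾ.+-identityˡ _ ⟩
  Σℚ (allFin m) (λ i → when (does (i ≟ j)) (f (suc i)))        ≡⟨ Σℚ-allFin-point j (f ∘ suc) ⟩
  f (suc j)                                                    ∎
  where open ≡-Reasoning

_≟ₛ_ : ∀ {n} → DecidableEquality (Subset n)
_≟ₛ_ = ≡-dec Boolᴾ._≟_

Σℚ-allSubsets-suc : ∀ n (f : Subset (suc n) → ℚ) →
  Σℚ (allSubsets (suc n)) f ≡ Σℚ (allSubsets n) (f ∘ (true ∷_)) + Σℚ (allSubsets n) (f ∘ (false ∷_))
Σℚ-allSubsets-suc n f = trans (Σℚ-++ (map (true ∷_) (allSubsets n)) _ f)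
  (cong₂ _+_ (Σℚ-map (true ∷_) (allSubsets n) f) (Σℚ-map (false ∷_) (allSubsets n) f))

Σℚ-allSubsets-point : ∀ {n} (T : Subset n) (f : Subset n → ℚ) →
                      Σℚ (allSubsets n) (λ S → when (does (S ≟ₛ T)) (f S)) ≡ f T
Σℚ-allSubsets-point {zero} [] f = ℚᴾ.+-identityʳ (f [])
Σℚ-allSubsets-point {suc n} (true ∷ T) f = begin
  Σℚ (allSubsets (suc n)) (λ S → when (does (S ≟ₛ (true ∷ T))) (f S))
    ≡⟨ Σℚ-allSubsets-suc n (λ S → when (does (S ≟ₛ (true ∷ T))) (f S)) ⟩
  Σℚ (allSubsets n) (λ S → when (does (S ≟ₛ T)) (f (true ∷ S))) + Σℚ (allSubsets n) (λ _ → 0ℚ)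
    ≡⟨ cong₂ _+_ (Σℚ-allSubsets-point T (f ∘ (true ∷_))) (Σℚ-zero (allSubsets n) (λ _ → refl)) ⟩
  f (true ∷ T) + 0ℚ   ≡⟨ ℚᴾ.+-identityʳ _ ⟩
  f (true ∷ T)        ∎
  where open ≡-Reasoning
Σℚ-allSubsets-point {suc n} (false ∷ T) f = begin
  Σℚ (allSubsets (suc n)) (λ S → when (does (S ≟ₛ (false ∷ T))) (f S))
    ≡⟨ Σℚ-allSubsets-suc n (λ S → when (does (S ≟ₛ (false ∷ T))) (f S)) ⟩
  Σℚ (allSubsets n) (λ _ → 0ℚ) + Σℚ (allSubsets n) (λ S → when (does (S ≟ₛ T)) (f (false ∷ S)))
    ≡⟨ cong₂ _+_ (Σℚ-zero (allSubsets n) (λ _ → refl)) (Σℚ-allSubsets-point T (f ∘ (false ∷_))) ⟩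
  0ℚ + f (false ∷ T)   ≡⟨ ℚᴾ.+-identityˡ _ ⟩
  f (false ∷ T)        ∎
  where open ≡-Reasoning

⁅⁆-injective : ∀ {n} {u v : Fin n} → ⁅ u ⁆ ≡ ⁅ v ⁆ → u ≡ v
⁅⁆-injective {u = zero}  {zero}  _    = refl
⁅⁆-injective {u = suc u} {suc v} same = cong suc (⁅⁆-injective (∷-injectiveʳ same))

lookup-⁅⁆ : ∀ {n} (v u : Fin n) → lookup ⁅ v ⁆ u ≡ does (v ≟ u)
lookup-⁅⁆ zero    zero    = refl
lookup-⁅⁆ zero    (suc u) = lookup-replicate u false
lookup-⁅⁆ (suc v) zero    = refl
lookup-⁅⁆ (suc v) (suc u) = lookup-⁅⁆ v u

∅-or-inhabited : ∀ {n} (S : Subset n) → S ≡ ∅ ⊎ 1 ≤ ∣ S ∣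
∅-or-inhabited []          = inj₁ refl
∅-or-inhabited (true ∷ S)  = inj₂ (s≤s z≤n)
∅-or-inhabited (false ∷ S) = Sum.map₁ (cong (false ∷_)) (∅-or-inhabited S)

singleton-or-large : ∀ {n} (S : Subset n) (v : Fin n) → lookup S v ≡ true → S ≡ ⁅ v ⁆ ⊎ 2 ≤ ∣ S ∣
singleton-or-large (true ∷ S)  zero    _   = Sum.map (cong (true ∷_)) s≤s (∅-or-inhabited S)
singleton-or-large (true ∷ S)  (suc v) v∈S = inj₂ (s≤s (inhabited (singleton-or-large S v v∈S)))
  where
  inhabited : S ≡ ⁅ v ⁆ ⊎ 2 ≤ ∣ S ∣ → 1 ≤ ∣ S ∣
  inhabited (inj₁ refl)  = ℕᴾ.≤-reflexive (sym (∣⁅x⁆∣≡1 v))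
  inhabited (inj₂ large) = ℕᴾ.<⇒≤ large
singleton-or-large (false ∷ S) (suc v) v∈S = Sum.map₁ (cong (false ∷_)) (singleton-or-large S v v∈S)

member-of-nonempty : ∀ {n} (S : Subset n) → any (lookup S) (allFin n) ≡ true → ∃ λ v → lookup S v ≡ true
member-of-nonempty {n} S nonempty =
  map₂ (Equivalence.to T-≡) (satisfied (any⁻ (lookup S) (allFin n) (Equivalence.from T-≡ nonempty)))

-- Walks that do not turn back at tight nodes

least : ∀ {P : ℕ → Set} → Decidable P → ∀ {k} → P k → ∃ λ j → P j × (∀ {t} → t < j → ¬ P t)
least P? {zero} p = 0 , p , λ { () }
least P? {suc k} p with P? 0
... | yes p₀ = 0 , p₀ , λ { () }
... | no ¬p₀ with j , pj , below ← least (P? ∘ suc) {k} p =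
  suc j , pj , λ { {zero} _ → ¬p₀ ; {suc t} (s≤s t<j) → below t<j }

module NonBacktrackingWalk
  {A : Set} {N : ℕ} (encode : A → Fin N) (encode-injective : ∀ {a b} → encode a ≡ encode b → a ≡ b)
  (Adj : A → A → Set) (Adj-sym : ∀ {p q} → Adj p q → Adj q p)
  (Tight : A → Set) (Tight? : Decidable Tight)
  (branch : ∀ {p q} → Adj p q → Tight q → ∃ λ r → Adj q r × r ≢ p)
  where

  record Trail : Set where
    field
      len             : ℕ
      node            : ℕ → A
      step            : ∀ t → Adj (node t) (node (suc t))
      nonempty        : 0 < len
      closed-or-loose : node 0 ≡ node len ⊎ (¬ Tight (node 0) × ¬ Tight (node len))
      first-step-once : ∀ {t} → 0 < t → t < len →
                        node t ≢ node 0 × (node t ≡ node 1 → node (suc t) ≢ node 0)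

  private
    _≟ᴬ_ : DecidableEquality A
    a ≟ᴬ b = Dec.map′ encode-injective (cong encode) (encode a ≟ encode b)

    -- At a node that is not tight the walk bounces back; it is only used up to such a node.
    continue : ∀ {p q} → Adj p q → Σ A (Adj q)
    continue {q = q} e with Tight? q
    ... | yes tight = let r , e′ , _ = branch e tight in r , e′
    ... | no _      = _ , Adj-sym e

    continue-avoids : ∀ {p q} (e : Adj p q) → Tight q → proj₁ (continue e) ≢ p
    continue-avoids {q = q} e tight with Tight? q
    ... | yes tight′ = proj₂ (proj₂ (branch e tight′))
    ... | no ¬tight  = contradiction tight ¬tight

  module _ {a₀ b₀ : A} (e₀ : Adj a₀ b₀) (start : ¬ Tight a₀ ⊎ (∀ {p q} → Adj p q → Tight q)) where

    private
      walk : ℕ → Σ A λ p → Σ A (Adj p)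
      walk zero    = a₀ , b₀ , e₀
      walk (suc t) = let _ , q , e = walk t in q , continue e

      node : ℕ → A
      node t = proj₁ (walk t)

      step : ∀ t → Adj (node t) (node (suc t))
      step t = proj₂ (proj₂ (walk t))

      Stop : ℕ → Set
      Stop t = (0 < t × ¬ Tight (node t)) ⊎ ∃ λ (i : Fin t) → node (toℕ i) ≡ node t

      stop? : Decidable Stop
      stop? t = (0 ℕ.<? t ×-dec ¬? (Tight? (node t))) ⊎-dec any? (λ i → node (toℕ i) ≟ᴬ node t)

      eventually-stops : ∃ Stop
      eventually-stops with i , j , i<j , same ← pigeonhole (ℕᴾ.n<1+n N) (encode ∘ node ∘ toℕ) =
        toℕ j , inj₂ (fromℕ< i<j , trans (cong node (toℕ-fromℕ< i<j)) (encode-injective same))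

      loose-start : ∀ {j} → 0 < j → ¬ Tight (node j) → ¬ Tight a₀
      loose-start {suc j} _ loose-end =
        [ id , (λ all-tight → contradiction (all-tight (step j)) loose-end) ]′ start

      module FirstStop {j} (no-earlier-stop : ∀ {t} → t < j → ¬ Stop t) where

        distinct : ∀ {a b} → a < b → b < j → node a ≢ node b
        distinct a<b b<j same =
          no-earlier-stop b<j (inj₂ (fromℕ< a<b , trans (cong node (toℕ-fromℕ< a<b)) same))

        tight-before : ∀ {t} → 0 < t → t < j → Tight (node t)
        tight-before 0<t t<j =
          decidable-stable (Tight? _) λ loose → no-earlier-stop t<j (inj₁ (0<t , loose))

        segment : ∀ s L → L ℕ.+ s ≡ j → 0 < L →
                  node s ≡ node j ⊎ (¬ Tight (node s) × ¬ Tight (node j)) → Trail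
        segment s L L+s≡j 0<L ends = record
          { len             = L
          ; node            = λ t → node (t ℕ.+ s)
          ; step            = λ t → step (t ℕ.+ s)
          ; nonempty        = 0<L
          ; closed-or-loose =
              subst (λ u → node s ≡ node u ⊎ (¬ Tight (node s) × ¬ Tight (node u))) (sym L+s≡j) ends
          ; first-step-once = once
          }
          where
          inside : ∀ {t} → t < L → t ℕ.+ s < j
          inside t<L = subst (_ <_) L+s≡j (ℕᴾ.+-monoˡ-< s t<L)

          no-return : ∀ t → suc t < L →
                      node (suc t ℕ.+ s) ≡ node (suc s) → node (suc (suc t) ℕ.+ s) ≢ node s
          no-return zero    t<L _    = continue-avoids (step s) (tight-before (s≤s z≤n) (inside t<L))
          no-return (suc t) t<L same =
            contradiction (sym same) (distinct (s≤s (s≤s (ℕᴾ.m≤n+m s t))) (inside t<L))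

          once : ∀ {t} → 0 < t → t < L →
                 node (t ℕ.+ s) ≢ node s × (node (t ℕ.+ s) ≡ node (suc s) → node (suc t ℕ.+ s) ≢ node s)
          once {suc t} _ t<L =
            (λ same → distinct (s≤s (ℕᴾ.m≤n+m s t)) (inside t<L) (sym same)) , no-return t t<L

        trail : Stop j → Trail
        trail (inj₁ (0<j , loose-end)) =
          segment 0 j (ℕᴾ.+-identityʳ j) 0<j (inj₂ (loose-start 0<j loose-end , loose-end))
        trail (inj₂ (i , same)) =
          segment (toℕ i) (j ∸ toℕ i) (ℕᴾ.m∸n+n≡m (ℕᴾ.<⇒≤ (toℕ<n i))) (ℕᴾ.m<n⇒0<n∸m (toℕ<n i))
                  (inj₁ same)

    trail-from : Trail
    trail-from with j , stop , earlier ← least stop? (proj₂ eventually-stops) = FirstStop.trail earlier stop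

-- The constraints of LR

Constraint : ℕ → ℕ → Set
Constraint n c = Fin n ⊎ Fin c

pattern cover v    = inj₁ v
pattern capacity k = inj₂ k

module Constraints {n c : ℕ} (D : LRData n c) where

  open LR D

  Σ𝒮 : Fin c → (Subset n → ℚ) → ℚ
  Σ𝒮 k f = Σℚ (allSubsets n) λ S → when (inX k S) (f S)

  ΣX-cong : ∀ {f g : Fin c → Subset n → ℚ} → (∀ k S → f k S ≡ g k S) → ΣX f ≡ ΣX g
  ΣX-cong f≗g = Σℚ-cong (allFin c) λ k → Σℚ-cong (allSubsets n) λ S → cong (when (inX k S)) (f≗g k S)

  ΣX-+ : ∀ (f g : Fin c → Subset n → ℚ) → ΣX (λ k S → f k S + g k S) ≡ ΣX f + ΣX g
  ΣX-+ f g = trans (Σℚ-cong (allFin c) split) (Σℚ-+ (allFin c) (λ k → Σ𝒮 k (f k)) (λ k → Σ𝒮 k (g k)))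
    where
    split : ∀ k → Σ𝒮 k (λ S → f k S + g k S) ≡ Σ𝒮 k (f k) + Σ𝒮 k (g k)
    split k = trans (Σℚ-cong (allSubsets n) λ S → when-+ (inX k S) (f k S) (g k S))
                    (Σℚ-+ (allSubsets n) (λ S → when (inX k S) (f k S)) (λ S → when (inX k S) (g k S)))

  ΣX-combination : ∀ {A : Set} (ts : List A) (s : A → ℚ) (f : A → Fin c → Subset n → ℚ) →
                   ΣX (λ k S → Σℚ ts (λ t → s t * f t k S)) ≡ Σℚ ts (λ t → s t * ΣX (f t))
  ΣX-combination ts s f = begin
    Σℚ (allFin c) (λ k → Σ𝒮 k λ S → Σℚ ts λ t → s t * f t k S)
      ≡⟨ Σℚ-cong (allFin c) inner ⟩
    Σℚ (allFin c) (λ k → Σℚ ts λ t → s t * Σ𝒮 k (f t k))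
      ≡⟨ Σℚ-comm (allFin c) ts (λ k t → s t * Σ𝒮 k (f t k)) ⟩
    Σℚ ts (λ t → Σℚ (allFin c) λ k → s t * Σ𝒮 k (f t k))
      ≡⟨ Σℚ-cong ts (λ t → Σℚ-*ˡ (allFin c) (s t) (λ k → Σ𝒮 k (f t k))) ⟩
    Σℚ ts (λ t → s t * ΣX (f t))   ∎
    where
    open ≡-Reasoning
    inner : ∀ k → Σ𝒮 k (λ S → Σℚ ts λ t → s t * f t k S) ≡ Σℚ ts λ t → s t * Σ𝒮 k (f t k)
    inner k = begin
      Σℚ (allSubsets n) (λ S → when (inX k S) (Σℚ ts λ t → s t * f t k S))
        ≡⟨ Σℚ-cong (allSubsets n) (λ S → trans (when-Σℚ (inX k S) ts (λ t → s t * f t k S))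
                                                (Σℚ-cong ts λ t → when-*ˡ (inX k S) (s t) (f t k S))) ⟩
      Σℚ (allSubsets n) (λ S → Σℚ ts λ t → s t * when (inX k S) (f t k S))
        ≡⟨ Σℚ-comm (allSubsets n) ts (λ S t → s t * when (inX k S) (f t k S)) ⟩
      Σℚ ts (λ t → Σℚ (allSubsets n) λ S → s t * when (inX k S) (f t k S))
        ≡⟨ Σℚ-cong ts (λ t → Σℚ-*ˡ (allSubsets n) (s t) (λ S → when (inX k S) (f t k S))) ⟩
      Σℚ ts (λ t → s t * Σ𝒮 k (f t k))   ∎

  ΣX-integral : ∀ {f : Fin c → Subset n → ℚ} → (∀ k S → InX k S → Integral (f k S)) → Integral (ΣX f)
  ΣX-integral {f} f-integral = Σℚ-integral (allFin c) λ k → Σℚ-integral (allSubsets n) (term k)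
    where
    term : ∀ k S → Integral (when (inX k S) (f k S))
    term k S with inX k S in inX≡
    ... | true  = f-integral k S inX≡
    ... | false = integral refl

  pick : Fin c → Subset n → Assignment n c → Assignment n c
  pick k₀ S₀ y k S = when (does (k ≟ k₀)) (when (does (S ≟ₛ S₀)) (y k S))

  ΣX-pick : ∀ {k₀ S₀} (y : Assignment n c) → InX k₀ S₀ → ΣX (pick k₀ S₀ y) ≡ y k₀ S₀
  ΣX-pick {k₀} {S₀} y inX₀ = begin
    Σℚ (allFin c) (λ k → Σ𝒮 k (pick k₀ S₀ y k))
      ≡⟨ Σℚ-cong (allFin c) inner ⟩
    Σℚ (allFin c) (λ k → when (does (k ≟ k₀)) (when (inX k S₀) (y k S₀)))
      ≡⟨ Σℚ-allFin-point k₀ (λ k → when (inX k S₀) (y k S₀)) ⟩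
    when (inX k₀ S₀) (y k₀ S₀)
      ≡⟨ cong (λ b → when b (y k₀ S₀)) inX₀ ⟩
    y k₀ S₀   ∎
    where
    open ≡-Reasoning
    reorder : ∀ a b c q → when a (when b (when c q)) ≡ when b (when c (when a q))
    reorder a b c q = trans (when-swap a b _) (cong (when b) (when-swap a c q))
    inner : ∀ k → Σ𝒮 k (pick k₀ S₀ y k) ≡ when (does (k ≟ k₀)) (when (inX k S₀) (y k S₀))
    inner k = begin
      Σℚ (allSubsets n) (λ S → when (inX k S) (pick k₀ S₀ y k S))
        ≡⟨ Σℚ-cong (allSubsets n) (λ S → reorder (inX k S) (does (k ≟ k₀)) (does (S ≟ₛ S₀)) (y k S)) ⟩
      Σℚ (allSubsets n) (λ S → when (does (k ≟ k₀)) (when (does (S ≟ₛ S₀)) (when (inX k S) (y k S))))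
        ≡⟨ sym (when-Σℚ (does (k ≟ k₀)) (allSubsets n)
                        λ S → when (does (S ≟ₛ S₀)) (when (inX k S) (y k S))) ⟩
      when (does (k ≟ k₀)) (Σℚ (allSubsets n) λ S → when (does (S ≟ₛ S₀)) (when (inX k S) (y k S)))
        ≡⟨ cong (when (does (k ≟ k₀))) (Σℚ-allSubsets-point S₀ λ S → when (inX k S) (y k S)) ⟩
      when (does (k ≟ k₀)) (when (inX k S₀) (y k S₀))   ∎

  inX-member : ∀ {k S} → InX k S → ∃ λ v → lookup S v ≡ true
  inX-member {k} {S} inX = member-of-nonempty S (Equivalence.to T-≡ (proj₂ (Equivalence.to (T-∧ {stableᵇ G S})
    (proj₂ (Equivalence.to (T-∧ {subsetᵇ G S (Vk D k)}) (Equivalence.from T-≡ inX))))))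
    where G = graph D

  occurs : Constraint n c → Fin c → Subset n → Bool
  occurs (cover v)     k S = lookup S v
  occurs (capacity k′) k S = does (k ≟ k′)

  lhs : Constraint n c → Assignment n c → ℚ
  lhs (cover v)    y = coverLHS y v
  lhs (capacity k) y = capLHS y k

  rhs : Constraint n c → ℚ
  rhs (cover v)    = 1ℚ
  rhs (capacity k) = ℕ→ℚ (m D k)

  row : Constraint n c → Assignment n c → ℚ
  row z y = ΣX λ k S → when (occurs z k S) (y k S)

  lhs≡row : ∀ z (y : Assignment n c) → lhs z y ≡ row z y
  lhs≡row (cover v)    y = refl
  lhs≡row (capacity k) y = sym (begin
    Σℚ (allFin c) (λ k′ → Σ𝒮 k′ λ S → when (does (k′ ≟ k)) (y k′ S))
      ≡⟨ Σℚ-cong (allFin c) (λ k′ → trans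
           (Σℚ-cong (allSubsets n) λ S → when-swap (inX k′ S) (does (k′ ≟ k)) (y k′ S))
           (sym (when-Σℚ (does (k′ ≟ k)) (allSubsets n) λ S → when (inX k′ S) (y k′ S)))) ⟩
    Σℚ (allFin c) (λ k′ → when (does (k′ ≟ k)) (Σ𝒮 k′ (y k′)))
      ≡⟨ Σℚ-allFin-point k (λ k′ → Σ𝒮 k′ (y k′)) ⟩
    capLHS y k   ∎)
    where open ≡-Reasoning

  lhs-cong : ∀ z {y y′ : Assignment n c} → (∀ k S → y k S ≡ y′ k S) → lhs z y ≡ lhs z y′
  lhs-cong z {y} {y′} y≗y′ = begin
    lhs z y    ≡⟨ lhs≡row z y ⟩
    row z y    ≡⟨ ΣX-cong (λ k S → cong (when (occurs z k S)) (y≗y′ k S)) ⟩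
    row z y′   ≡⟨ sym (lhs≡row z y′) ⟩
    lhs z y′   ∎
    where open ≡-Reasoning

  lhs-+ : ∀ z (y y′ : Assignment n c) → lhs z (λ k S → y k S + y′ k S) ≡ lhs z y + lhs z y′
  lhs-+ z y y′ = begin
    lhs z (λ k S → y k S + y′ k S)
      ≡⟨ lhs≡row z _ ⟩
    ΣX (λ k S → when (occurs z k S) (y k S + y′ k S))
      ≡⟨ ΣX-cong (λ k S → when-+ (occurs z k S) (y k S) (y′ k S)) ⟩
    ΣX (λ k S → when (occurs z k S) (y k S) + when (occurs z k S) (y′ k S))
      ≡⟨ ΣX-+ (λ k S → when (occurs z k S) (y k S)) (λ k S → when (occurs z k S) (y′ k S)) ⟩
    row z y + row z y′
      ≡⟨ sym (cong₂ _+_ (lhs≡row z y) (lhs≡row z y′)) ⟩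
    lhs z y + lhs z y′   ∎
    where open ≡-Reasoning

  lhs-combination : ∀ z {A : Set} (ts : List A) (s : A → ℚ) (f : A → Assignment n c) →
                    lhs z (λ k S → Σℚ ts (λ t → s t * f t k S)) ≡ Σℚ ts (λ t → s t * lhs z (f t))
  lhs-combination z ts s f = begin
    lhs z (λ k S → Σℚ ts (λ t → s t * f t k S))
      ≡⟨ lhs≡row z _ ⟩
    ΣX (λ k S → when (occurs z k S) (Σℚ ts (λ t → s t * f t k S)))
      ≡⟨ ΣX-cong (λ k S → trans (when-Σℚ (occurs z k S) ts λ t → s t * f t k S)
                                (Σℚ-cong ts λ t → when-*ˡ (occurs z k S) (s t) (f t k S))) ⟩
    ΣX (λ k S → Σℚ ts (λ t → s t * when (occurs z k S) (f t k S)))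
      ≡⟨ ΣX-combination ts s (λ t k S → when (occurs z k S) (f t k S)) ⟩
    Σℚ ts (λ t → s t * row z (f t))
      ≡⟨ Σℚ-cong ts (λ t → cong (s t *_) (sym (lhs≡row z (f t)))) ⟩
    Σℚ ts (λ t → s t * lhs z (f t))   ∎
    where open ≡-Reasoning

  lhs-pick : ∀ z {k₀ S₀} (y : Assignment n c) → InX k₀ S₀ →
             lhs z (pick k₀ S₀ y) ≡ when (occurs z k₀ S₀) (y k₀ S₀)
  lhs-pick z {k₀} {S₀} y inX₀ = begin
    lhs z (pick k₀ S₀ y)
      ≡⟨ lhs≡row z _ ⟩
    ΣX (λ k S → when (occurs z k S) (pick k₀ S₀ y k S))
      ≡⟨ ΣX-cong (λ k S → trans (when-swap (occurs z k S) (does (k ≟ k₀)) _)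
                                (cong (when (does (k ≟ k₀))) (when-swap (occurs z k S) (does (S ≟ₛ S₀)) (y k S)))) ⟩
    ΣX (pick k₀ S₀ (λ k S → when (occurs z k S) (y k S)))
      ≡⟨ ΣX-pick (λ k S → when (occurs z k S) (y k S)) inX₀ ⟩
    when (occurs z k₀ S₀) (y k₀ S₀)   ∎
    where open ≡-Reasoning

  lhs-isolate : ∀ z {k₀ S₀} (y : Assignment n c) →
                Integral (lhs z y) → InX k₀ S₀ → occurs z k₀ S₀ ≡ true →
                (∀ k S → InX k S → occurs z k S ≡ true → ¬ (k ≡ k₀ × S ≡ S₀) → Integral (y k S)) →
                Integral (y k₀ S₀)
  lhs-isolate z {k₀} {S₀} y lhs-integral inX₀ occurs₀ others =
    integral-cancelʳ (y k₀ S₀) (lhs z rest) (subst Integral split lhs-integral)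
      (subst Integral (sym (lhs≡row z rest)) (ΣX-integral rest-integral))
    where
    rest : Assignment n c
    rest k S = when (not (does (k ≟ k₀) ∧ does (S ≟ₛ S₀))) (y k S)

    pick+rest : ∀ k S → y k S ≡ pick k₀ S₀ y k S + rest k S
    pick+rest k S with does (k ≟ k₀) | does (S ≟ₛ S₀)
    ... | true  | true  = sym (ℚᴾ.+-identityʳ (y k S))
    ... | true  | false = sym (ℚᴾ.+-identityˡ (y k S))
    ... | false | _     = sym (ℚᴾ.+-identityˡ (y k S))

    split : lhs z y ≡ y k₀ S₀ + lhs z rest
    split = begin
      lhs z y
        ≡⟨ lhs-cong z pick+rest ⟩
      lhs z (λ k S → pick k₀ S₀ y k S + rest k S)
        ≡⟨ lhs-+ z (pick k₀ S₀ y) rest ⟩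
      lhs z (pick k₀ S₀ y) + lhs z rest
        ≡⟨ cong (_+ lhs z rest) (lhs-pick z y inX₀) ⟩
      when (occurs z k₀ S₀) (y k₀ S₀) + lhs z rest
        ≡⟨ cong (λ b → when b (y k₀ S₀) + lhs z rest) occurs₀ ⟩
      y k₀ S₀ + lhs z rest   ∎
      where open ≡-Reasoning

    rest-integral : ∀ k S → InX k S →
      Integral (when (occurs z k S) (when (not (does (k ≟ k₀) ∧ does (S ≟ₛ S₀))) (y k S)))
    rest-integral k S inX with occurs z k S in occurs≡ | k ≟ k₀ | S ≟ₛ S₀
    ... | false | _        | _        = integral refl
    ... | true  | yes refl | yes refl = integral refl
    ... | true  | yes refl | no S≢S₀  = others k S inX occurs≡ (S≢S₀ ∘ proj₂)
    ... | true  | no k≢k₀  | _        = others k S inX occurs≡ (k≢k₀ ∘ proj₁)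

-- The graph of fractional singleton variables

from-does : ∀ {P : Set} (d : Dec P) → does d ≡ true → P
from-does (yes p) _ = p
from-does (no _)  ()

join-injective : ∀ m n {a b : Fin m ⊎ Fin n} → join m n a ≡ join m n b → a ≡ b
join-injective m n {a} {b} same =
  trans (sym (splitAt-join m n a)) (trans (cong (splitAt m) same) (splitAt-join m n b))

module FractionalSingletons {n c : ℕ} (D : LRData n c) (x : Assignment n c)
  (large-integral : ∀ k S → LR.InX D k S → 2 ≤ ∣ S ∣ → Integral (x k S)) where

  open LR D
  open Constraints D

  FracEdge : Fin c → Fin n → Set
  FracEdge k v = InX k ⁅ v ⁆ × ¬ Integral (x k ⁅ v ⁆)

  fracEdge? : ∀ k v → Dec (FracEdge k v)
  fracEdge? k v = (inX k ⁅ v ⁆ Boolᴾ.≟ true) ×-dec ¬? (integral? (x k ⁅ v ⁆))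

  integral-unless-fracEdge : ∀ {k S} → InX k S → (∀ v → S ≡ ⁅ v ⁆ → ¬ FracEdge k v) → Integral (x k S)
  integral-unless-fracEdge {k} {S} inX no-edge
    with v , v∈S ← inX-member {k} {S} inX with singleton-or-large S v v∈S
  ... | inj₂ large = large-integral k S inX large
  ... | inj₁ refl  = decidable-stable (integral? _) λ non-integral → no-edge v refl (inX , non-integral)

  data Adj : Constraint n c → Constraint n c → Set where
    cover-capacity : ∀ {k v} → FracEdge k v → Adj (cover v) (capacity k)
    capacity-cover : ∀ {k v} → FracEdge k v → Adj (capacity k) (cover v)

  Adj-sym : ∀ {a b} → Adj a b → Adj b a
  Adj-sym (cover-capacity e) = capacity-cover e
  Adj-sym (capacity-cover e) = cover-capacity e

  edgeOf : ∀ {a b} → Adj a b → Fin c × Fin n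
  edgeOf (cover-capacity {k} {v} _) = k , v
  edgeOf (capacity-cover {k} {v} _) = k , v

  edgeOf-fracEdge : ∀ {a b} (e : Adj a b) → FracEdge (proj₁ (edgeOf e)) (proj₂ (edgeOf e))
  edgeOf-fracEdge (cover-capacity e) = e
  edgeOf-fracEdge (capacity-cover e) = e

  edgeOf-injective : ∀ {a b a′ b′} (e : Adj a b) (e′ : Adj a′ b′) → edgeOf e ≡ edgeOf e′ →
                     (a ≡ a′ × b ≡ b′) ⊎ (a ≡ b′ × b ≡ a′)
  edgeOf-injective (cover-capacity _) (cover-capacity _) refl = inj₁ (refl , refl)
  edgeOf-injective (cover-capacity _) (capacity-cover _) refl = inj₂ (refl , refl)
  edgeOf-injective (capacity-cover _) (cover-capacity _) refl = inj₂ (refl , refl)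
  edgeOf-injective (capacity-cover _) (capacity-cover _) refl = inj₁ (refl , refl)

  Tight : Constraint n c → Set
  Tight z = lhs z x ≡ rhs z

  Tight? : Decidable Tight
  Tight? z = lhs z x ℚᴾ.≟ rhs z

  branch : ∀ {p q} → Adj p q → Tight q → ∃ λ r → Adj q r × r ≢ p
  branch (capacity-cover {k₀} {v} e) tight with any? (λ k → fracEdge? k v ×-dec ¬? (k ≟ k₀))
  ... | yes (k , e′ , k≢k₀) = capacity k , cover-capacity e′ , k≢k₀ ∘ Sumᴾ.inj₂-injective
  ... | no only-k₀ = contradiction
    (lhs-isolate (cover v) x (subst Integral (sym tight) (integral refl)) (proj₁ e) v∈⁅v⁆ others) (proj₂ e)
    where
    v∈⁅v⁆ : lookup ⁅ v ⁆ v ≡ true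
    v∈⁅v⁆ = trans (lookup-⁅⁆ v v) (dec-true (v ≟ v) refl)
    others : ∀ k S → InX k S → lookup S v ≡ true → ¬ (k ≡ k₀ × S ≡ ⁅ v ⁆) → Integral (x k S)
    others k S inX v∈S not-k₀v = integral-unless-fracEdge inX λ where
      u refl e′ → let u≡v = from-does (u ≟ v) (trans (sym (lookup-⁅⁆ u v)) v∈S) in
        not-k₀v ( decidable-stable (k ≟ k₀) (λ k≢k₀ → only-k₀ (k , subst (FracEdge k) u≡v e′ , k≢k₀))
                , cong ⁅_⁆ u≡v )
  branch (cover-capacity {k} {v₀} e) tight with any? (λ v → fracEdge? k v ×-dec ¬? (v ≟ v₀))
  ... | yes (v , e′ , v≢v₀) = cover v , capacity-cover e′ , v≢v₀ ∘ Sumᴾ.inj₁-injective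
  ... | no only-v₀ = contradiction
    (lhs-isolate (capacity k) x (subst Integral (sym tight) (integral-/1 (ℤ.+ m D k))) (proj₁ e)
                 (dec-true (k ≟ k) refl) others)
    (proj₂ e)
    where
    others : ∀ k′ S → InX k′ S → does (k′ ≟ k) ≡ true → ¬ (k′ ≡ k × S ≡ ⁅ v₀ ⁆) → Integral (x k′ S)
    others k′ S inX k′≟k not-kv₀ with refl ← from-does (k′ ≟ k) k′≟k =
      integral-unless-fracEdge inX λ where
        u refl e′ → not-kv₀ (refl , cong ⁅_⁆ (decidable-stable (u ≟ v₀) λ u≢v₀ → only-v₀ (u , e′ , u≢v₀)))

  open NonBacktrackingWalk (join n c) (join-injective n c) Adj Adj-sym Tight Tight? branch

  sign : Constraint n c → ℚ
  sign (cover _)    = 1ℚ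
  sign (capacity _) = - 1ℚ

  sign-nonzero : ∀ a → sign a ≢ 0ℚ
  sign-nonzero (cover _)    ()
  sign-nonzero (capacity _) ()

  _≟ᶜ_ : DecidableEquality (Constraint n c)
  _≟ᶜ_ = Sumᴾ.≡-dec _≟_ _≟_

  charge : Constraint n c → Constraint n c → ℚ
  charge a z = sign a * when (does (a ≟ᶜ z)) 1ℚ

  unit : Fin c × Fin n → Assignment n c
  unit (k , v) = pick k ⁅ v ⁆ (λ _ _ → 1ℚ)

  unit-self : ∀ k v → unit (k , v) k ⁅ v ⁆ ≡ 1ℚ
  unit-self k v rewrite dec-true (k ≟ k) refl | dec-true (⁅ v ⁆ ≟ₛ ⁅ v ⁆) refl = refl

  unit-elsewhere : ∀ {e} k v → (k , v) ≢ e → unit e k ⁅ v ⁆ ≡ 0ℚ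
  unit-elsewhere {e} k v ne with k ≟ proj₁ e | ⁅ v ⁆ ≟ₛ ⁅ proj₂ e ⁆
  ... | yes refl | yes same = contradiction (cong (k ,_) (⁅⁆-injective same)) ne
  ... | yes _    | no _     = refl
  ... | no _     | _        = refl

  -- Signs alternate along an edge, so an edge's contribution to a row is a difference of charges.
  step-charge : ∀ {a b} (e : Adj a b) z → sign a * lhs z (unit (edgeOf e)) ≡ charge a z - charge b z
  step-charge {a} e z =
    trans (cong (sign a *_) (lhs-pick z (λ _ _ → 1ℚ) (proj₁ (edgeOf-fracEdge e)))) (crossing e z)
    where
    crossing : ∀ {a b} (e : Adj a b) z →
               sign a * when (occurs z (proj₁ (edgeOf e)) ⁅ proj₂ (edgeOf e) ⁆) 1ℚ ≡ charge a z - charge b z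
    crossing (cover-capacity {k} {v} _) (cover u) rewrite lookup-⁅⁆ v u with does (v ≟ u)
    ... | true  = refl
    ... | false = refl
    crossing (cover-capacity {k} {v} _) (capacity k′) with does (k ≟ k′)
    ... | true  = refl
    ... | false = refl
    crossing (capacity-cover {k} {v} _) (cover u) rewrite lookup-⁅⁆ v u with does (v ≟ u)
    ... | true  = refl
    ... | false = refl
    crossing (capacity-cover {k} {v} _) (capacity k′) with does (k ≟ k′)
    ... | true  = refl
    ... | false = refl

  module Perturbation (T : Trail) where

    open Trail T

    edge : ℕ → Fin c × Fin n
    edge t = edgeOf (step t)

    direction : Assignment n c
    direction k S = Σℚ (upTo len) λ t → sign (node t) * unit (edge t) k S

    lhs-direction : ∀ z → Tight z → lhs z direction ≡ 0ℚ
    lhs-direction z tight = begin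
      lhs z direction
        ≡⟨ lhs-combination z (upTo len) (sign ∘ node) (unit ∘ edge) ⟩
      Σℚ (upTo len) (λ t → sign (node t) * lhs z (unit (edge t)))
        ≡⟨ Σℚ-cong (upTo len) (λ t → step-charge (step t) z) ⟩
      Σℚ (upTo len) (λ t → charge (node t) z - charge (node (suc t)) z)
        ≡⟨ telescope len (λ t → charge (node t) z) ⟩
      charge (node 0) z - charge (node len) z
        ≡⟨ boundary closed-or-loose ⟩
      0ℚ   ∎
      where
      open ≡-Reasoning
      charge-elsewhere : ∀ {a} → ¬ Tight a → charge a z ≡ 0ℚ
      charge-elsewhere {a} loose =
        trans (cong (λ b → sign a * when b 1ℚ) (dec-false (a ≟ᶜ z) λ { refl → loose tight }))
              (ℚᴾ.*-zeroʳ (sign a))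
      boundary : node 0 ≡ node len ⊎ (¬ Tight (node 0) × ¬ Tight (node len)) →
                 charge (node 0) z - charge (node len) z ≡ 0ℚ
      boundary (inj₁ closed) =
        trans (cong (λ a → charge (node 0) z - charge a z) (sym closed)) (ℚᴾ.+-inverseʳ (charge (node 0) z))
      boundary (inj₂ (loose₀ , looseₗ)) =
        cong₂ _-_ (charge-elsewhere {node 0} loose₀) (charge-elsewhere {node len} looseₗ)

    direction-vanishes : ∀ k S → x k S ≡ 0ℚ → direction k S ≡ 0ℚ
    direction-vanishes k S x≡0 = Σℚ-zero (upTo len) λ {t} _ → term t
      where
      term : ∀ t → sign (node t) * unit (edge t) k S ≡ 0ℚ
      term t with k ≟ proj₁ (edge t) | S ≟ₛ ⁅ proj₂ (edge t) ⁆
      ... | yes refl | yes refl =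
        contradiction (subst Integral (sym x≡0) (integral refl)) (proj₂ (edgeOf-fracEdge (step t)))
      ... | yes _    | no _     = ℚᴾ.*-zeroʳ (sign (node t))
      ... | no _     | _        = ℚᴾ.*-zeroʳ (sign (node t))

    direction-at-first-edge : direction (proj₁ (edge 0)) ⁅ proj₂ (edge 0) ⁆ ≡ sign (node 0)
    direction-at-first-edge = trans (Σℚ-upTo-head _ nonempty later)
      (trans (cong (sign (node 0) *_) (unit-self (proj₁ (edge 0)) (proj₂ (edge 0)))) (ℚᴾ.*-identityʳ _))
      where
      later : ∀ {t} → 0 < t → t < len →
              sign (node t) * unit (edge t) (proj₁ (edge 0)) ⁅ proj₂ (edge 0) ⁆ ≡ 0ℚ
      later {t} 0<t t<len = trans (cong (sign (node t) *_) (unit-elsewhere _ _ λ same →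
          [ (λ (back , _) → proj₁ (first-step-once 0<t t<len) (sym back))
          , (λ (p , q) → proj₂ (first-step-once 0<t t<len) (sym q) (sym p)) ]′
          (edgeOf-injective (step 0) (step t) same)))
        (ℚᴾ.*-zeroʳ (sign (node t)))

    not-basic : ¬ Basic x
    not-basic (_ , unique) = sign-nonzero (node 0) (trans (sym direction-at-first-edge) direction-zero)
      where
      k₀ = proj₁ (edge 0)
      v₀ = proj₂ (edge 0)
      tight-preserved : ∀ z → Tight z → lhs z (λ k S → x k S + direction k S) ≡ rhs z
      tight-preserved z tight = trans (lhs-+ z x direction)
        (trans (cong₂ _+_ tight (lhs-direction z tight)) (ℚᴾ.+-identityʳ (rhs z)))
      unchanged : x k₀ ⁅ v₀ ⁆ + direction k₀ ⁅ v₀ ⁆ ≡ x k₀ ⁅ v₀ ⁆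
      unchanged = unique (λ k S → x k S + direction k S)
        (λ v → tight-preserved (cover v)) (λ k → tight-preserved (capacity k))
        (λ k S _ x≡0 → trans (cong₂ _+_ x≡0 (direction-vanishes k S x≡0)) (ℚᴾ.+-identityʳ 0ℚ))
        k₀ ⁅ v₀ ⁆ (proj₁ (edgeOf-fracEdge (step 0)))
      direction-zero : direction k₀ ⁅ v₀ ⁆ ≡ 0ℚ
      direction-zero = identityʳ-unique ℚᴾ.+-0-group (x k₀ ⁅ v₀ ⁆) (direction k₀ ⁅ v₀ ⁆) unchanged

  no-fracEdge : Basic x → ∀ k v → ¬ FracEdge k v
  no-fracEdge basic k v e
    with any? (λ k′ → any? (λ v′ →
           fracEdge? k′ v′ ×-dec (¬? (Tight? (cover v′)) ⊎-dec ¬? (Tight? (capacity k′)))))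
  ... | yes (k′ , v′ , e′ , inj₁ loose) = Perturbation.not-basic (trail-from (cover-capacity e′) (inj₁ loose)) basic
  ... | yes (k′ , v′ , e′ , inj₂ loose) = Perturbation.not-basic (trail-from (capacity-cover e′) (inj₁ loose)) basic
  ... | no none = Perturbation.not-basic (trail-from (cover-capacity e) (inj₂ all-tight)) basic
    where
    all-tight : ∀ {p q} → Adj p q → Tight q
    all-tight (cover-capacity {k′} {v′} e′) =
      decidable-stable (Tight? (capacity k′)) λ loose → none (k′ , v′ , e′ , inj₂ loose)
    all-tight (capacity-cover {k′} {v′} e′) =
      decidable-stable (Tight? (cover v′)) λ loose → none (k′ , v′ , e′ , inj₁ loose)

  basic⇒integral : Basic x → ∀ k S → InX k S → Integral (x k S)
  basic⇒integral basic k S inX = integral-unless-fracEdge inX λ v _ → no-fracEdge basic k v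

lemma4 : {n c : ℕ} (D : LRData n c) → (∀ k → 0 < m D k) → (x : Assignment n c)
    → LR.Basic D x → LR.Optimal D x
    → Σ (Fin c) (λ k → Σ (Subset n) λ S → LR.InX D k S × Fractional (x k S))
    → Σ (Fin c) (λ k → Σ (Subset n) λ S → LR.InX D k S × (2 ≤ ∣ S ∣) × Fractional (x k S))
lemma4 D _ x basic _ (k , S , inX , fractional)
  with any? (λ k → anySubset? (λ S →
         (LR.inX D k S Boolᴾ.≟ true) ×-dec (2 ℕ.≤? ∣ S ∣) ×-dec ¬? (integral? (x k S))))
... | yes (k′ , S′ , inX′ , large , non-integral) = k′ , S′ , inX′ , large , non-integral ∘ isIntegral⇒integral
... | no none = contradiction (integral⇒isIntegral (basic⇒integral basic k S inX)) fractional
  where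
  large-integral : ∀ k S → LR.InX D k S → 2 ≤ ∣ S ∣ → Integral (x k S)
  large-integral k S inX large =
    decidable-stable (integral? (x k S)) λ non-integral → none (k , S , inX , large , non-integral)
  open FractionalSingletons D x large-integral using (basic⇒integral)
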